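{- For every integer $k \geq 1$ we have $\omega(k) \leq \frac{5}{3}\, m(k)$.
   Context: Let $(a(n))_{n\ge 0}$ be the Rudin-Shapiro sequence, defined by $a(0)=1$, $a(2n)=a(n)$, $a(2n+1)=(-1)^n a(n)$ for $n\ge 0$. Let $s(n)=\sum_{0\le i\le n} a(i)$. For $k\ge 1$, $\omega(k)$ is the largest $n\ge0$ with $s(n)=k$ (every positive integer is a value of $s$, attained finitely often). For $k\ge 0$, $m(k)$ denotes the integer obtained by reading the base-$2$ representation of $k$ as a base-$4$ numeral; i.e., if $k=\sum_i c_i 2^i$ with $c_i\in\{0,1\}$, then $m(k)=\sum_i c_i 4^i$. -}

module Defs where

open import Data.Nat using (ℕ; zero; suc; _+_; _*_; _≤_)
open import Data.Nat.DivMod using (_/_; _%_)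
open import Data.Integer as ℤ using (ℤ; +_; -_)
open import Data.Product using (_×_)
open import Relation.Binary.PropositionalEquality using (_≡_)

sign : ℕ → ℤ
sign zero = + 1
sign (suc n) = - sign n

-- Rudin-Shapiro with fuel: a(0)=1, a(2n)=a(n), a(2n+1)=(-1)^n a(n).
-- Fuel ≥ n suffices since n/2 < n for n ≥ 1.
rsF : ℕ → ℕ → ℤ
rsF zero n = + 1
rsF (suc f) zero = + 1
rsF (suc f) (suc n) with (suc n) % 2
... | zero = rsF f ((suc n) / 2)
... | suc _ = sign ((suc n) / 2) ℤ.* rsF f ((suc n) / 2)

a : ℕ → ℤ
a n = rsF n n

s : ℕ → ℤ
s zero = a zero
s (suc n) = s n ℤ.+ a (suc n)

IsOmega : ℕ → ℕ → Set
IsOmega k n = (s n ≡ + k) × (∀ n' → s n' ≡ + k → n' ≤ n)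

m : ℕ → ℕ
m k = go k k
  where
  go : ℕ → ℕ → ℕ
  go zero _ = 0
  go (suc f) zero = 0
  go (suc f) (suc k) = ((suc k) % 2) + 4 * go f ((suc k) / 2)

{-# OPTIONS --safe #-}
-- Write b(n) = (-1)^n a(n). For n = r + 4q the pair (a(n), b(n)) is read off from
-- (a(q), b(q)) and r, and s(n) = 2 s(q) + δ with δ = -a(q), 0, b(q), 0 for r = 0, 1, 2, 3,
-- while m(2j) = 4 m(j) and m(2j+1) = 4 m(j) + 1. By base-4 induction, whenever s(n) = j + 1
-- one of three linear bounds holds, selected by the signs (a(n), b(n)):
--   (±,-): 3n + 2 ≤ 5 m(j),   (+,+): 3n ≤ 5 m(j),   (-,+): 3n + 2 ≤ 2 m(j+1) + 3 m(j).
-- Since m is strictly increasing, each bound implies the next one, and the last implies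
-- 3n ≤ 5 m(j+1) = 5 m(s(n)); the four digits map the bounds into each other after
-- multiplying by 4.
module Submission where

open import Defs
open import Data.Nat
open import Data.Nat.Properties
open import Data.Nat.DivMod
open import Data.Nat.Divisibility using (m∣m*n)
open import Data.Nat.Induction using (<-rec)
import Data.Nat.Tactic.RingSolver as ℕ-Solver
open import Data.Integer as ℤ using (ℤ; _◃_; 1ℤ; -1ℤ)
import Data.Integer.Properties as ℤ
import Data.Integer.Tactic.RingSolver as ℤ-Solver
open import Data.Sign as Sign using (Sign)
open import Data.Product using (_,_)
open import Function using (_∘_; _$_; id)
open import Relation.Binary.PropositionalEquality

module _ (b : ℕ) .{{_ : NonZero b}} where

  digit-% : ∀ {r} q → r < b → (r + b * q) % b ≡ r
  digit-% {r} q r<b = begin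
    (r + b * q) % b  ≡⟨ cong (λ x → (r + x) % b) (*-comm b q) ⟩
    (r + q * b) % b  ≡⟨ [m+kn]%n≡m%n r q b ⟩
    r % b            ≡⟨ m<n⇒m%n≡m r<b ⟩
    r                ∎
    where open ≡-Reasoning

  digit-/ : ∀ {r} q → r < b → (r + b * q) / b ≡ q
  digit-/ {r} q r<b = begin
    (r + b * q) / b    ≡⟨ +-distrib-/-∣ʳ r (m∣m*n q) ⟩
    r / b + b * q / b  ≡⟨ cong₂ _+_ (m<n⇒m/n≡0 r<b) (trans (cong (_/ b) (*-comm b q)) (m*n/n≡m q b)) ⟩
    q                  ∎
    where open ≡-Reasoning

digit-induction : ∀ b .{{_ : NonZero b}} → 1 < b → (P : ℕ → Set) → P 0 →
                  (∀ {q} r → r < b → P q → P (r + b * q)) → ∀ n → P n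
digit-induction b 1<b P P0 step = <-rec P go
  where
  go : ∀ n → (∀ {k} → k < n → P k) → P n
  go zero      _   = P0
  go n@(suc _) rec = subst P (sym n≡r+bq) (step (n % b) (m%n<n n b) (rec (m/n<m n b 1<b)))
    where
    n≡r+bq : n ≡ n % b + b * (n / b)
    n≡r+bq = trans (m≡m%n+[m/n]*n n b) (cong (λ i → n % b + i) (*-comm (n / b) b))

[1+n]/2≤n : ∀ n → suc n / 2 ≤ n
[1+n]/2≤n n = ≤-pred (m/n<m (suc n) 2 (s<s z<s))

-- The Rudin-Shapiro sequence

rsF-fuel : ∀ {f g} n → n ≤ f → n ≤ g → rsF f n ≡ rsF g n
rsF-fuel {zero}  {zero}  zero _ _ = refl
rsF-fuel {zero}  {suc _} zero _ _ = refl
rsF-fuel {suc _} {zero}  zero _ _ = refl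
rsF-fuel {suc _} {suc _} zero _ _ = refl
rsF-fuel {suc f} {suc g} (suc n) (s≤s n≤f) (s≤s n≤g) with suc n % 2
... | zero  = rsF-fuel (suc n / 2) (≤-trans ([1+n]/2≤n n) n≤f) (≤-trans ([1+n]/2≤n n) n≤g)
... | suc _ = cong (sign (suc n / 2) ℤ.*_)
                   (rsF-fuel (suc n / 2) (≤-trans ([1+n]/2≤n n) n≤f) (≤-trans ([1+n]/2≤n n) n≤g))

rsF-even : ∀ f n → suc n % 2 ≡ 0 → rsF (suc f) (suc n) ≡ rsF f (suc n / 2)
rsF-even f n p with suc n % 2 | p
... | zero | _ = refl

rsF-odd : ∀ f n → suc n % 2 ≡ 1 → rsF (suc f) (suc n) ≡ sign (suc n / 2) ℤ.* rsF f (suc n / 2)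
rsF-odd f n p with suc n % 2 | p
... | suc zero | _ = refl

a-suc-even : ∀ n → suc n % 2 ≡ 0 → a (suc n) ≡ a (suc n / 2)
a-suc-even n p = trans (rsF-even n n p) (rsF-fuel (suc n / 2) ([1+n]/2≤n n) ≤-refl)

a-suc-odd : ∀ n → suc n % 2 ≡ 1 → a (suc n) ≡ sign (suc n / 2) ℤ.* a (suc n / 2)
a-suc-odd n p = trans (rsF-odd n n p)
                      (cong (sign (suc n / 2) ℤ.*_) (rsF-fuel (suc n / 2) ([1+n]/2≤n n) ≤-refl))

b : ℕ → ℤ
b n = sign n ℤ.* a n

a-even : ∀ n → a (2 * n) ≡ a n
a-even zero    = refl
a-even (suc n) = trans (a-suc-even (pred (2 * suc n)) (digit-% 2 (suc n) z<s)) (cong a (digit-/ 2 (suc n) z<s))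

a-odd : ∀ n → a (1 + 2 * n) ≡ b n
a-odd n = trans (a-suc-odd (2 * n) (digit-% 2 n (s<s z<s))) (cong b (digit-/ 2 n (s<s z<s)))

sign-even : ∀ n → sign (2 * n) ≡ 1ℤ
sign-even zero    = refl
sign-even (suc n) = begin
  sign (2 * suc n)      ≡⟨ cong (λ i → ℤ.- sign i) (+-suc n (n + 0)) ⟩
  ℤ.- ℤ.- sign (2 * n)  ≡⟨ ℤ.neg-involutive _ ⟩
  sign (2 * n)          ≡⟨ sign-even n ⟩
  1ℤ                    ∎
  where open ≡-Reasoning

b-even : ∀ n → b (2 * n) ≡ a n
b-even n = trans (cong₂ ℤ._*_ (sign-even n) (a-even n)) (ℤ.*-identityˡ (a n))

b-odd : ∀ n → b (1 + 2 * n) ≡ ℤ.- b n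
b-odd n = trans (cong₂ ℤ._*_ (cong ℤ.-_ (sign-even n)) (a-odd n)) (ℤ.-1*i≡-i (b n))

4q≡2[2q] : ∀ q → 4 * q ≡ 2 * (2 * q)
4q≡2[2q] q = *-assoc 2 2 q

2+4q≡2[1+2q] : ∀ q → 2 + 4 * q ≡ 2 * (1 + 2 * q)
2+4q≡2[1+2q] q = trans (cong (λ i → 2 + i) (4q≡2[2q] q)) (sym (*-distribˡ-+ 2 1 (2 * q)))

a-4q : ∀ q → a (4 * q) ≡ a q
a-4q q = trans (cong a (4q≡2[2q] q)) (trans (a-even (2 * q)) (a-even q))

a-1+4q : ∀ q → a (1 + 4 * q) ≡ a q
a-1+4q q = trans (cong (a ∘ suc) (4q≡2[2q] q)) (trans (a-odd (2 * q)) (b-even q))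

a-2+4q : ∀ q → a (2 + 4 * q) ≡ b q
a-2+4q q = trans (cong a (2+4q≡2[1+2q] q)) (trans (a-even (1 + 2 * q)) (a-odd q))

a-3+4q : ∀ q → a (3 + 4 * q) ≡ ℤ.- b q
a-3+4q q = trans (cong (a ∘ suc) (2+4q≡2[1+2q] q)) (trans (a-odd (1 + 2 * q)) (b-odd q))

b-4q : ∀ q → b (4 * q) ≡ a q
b-4q q = trans (cong b (4q≡2[2q] q)) (trans (b-even (2 * q)) (a-even q))

b-1+4q : ∀ q → b (1 + 4 * q) ≡ ℤ.- a q
b-1+4q q = trans (cong (b ∘ suc) (4q≡2[2q] q)) (trans (b-odd (2 * q)) (cong ℤ.-_ (b-even q)))

b-2+4q : ∀ q → b (2 + 4 * q) ≡ b q
b-2+4q q = trans (cong b (2+4q≡2[1+2q] q)) (trans (b-even (1 + 2 * q)) (a-odd q))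

b-3+4q : ∀ q → b (3 + 4 * q) ≡ b q
b-3+4q q = trans (cong (b ∘ suc) (2+4q≡2[1+2q] q))
                 (trans (b-odd (1 + 2 * q)) (trans (cong ℤ.-_ (b-odd q)) (ℤ.neg-involutive (b q))))

-- Partial sums

x+y-y≡x : ∀ x y → x ℤ.+ y ℤ.- y ≡ x
x+y-y≡x = ℤ-Solver.solve-∀

s[n]≡s[1+n]-a[1+n] : ∀ n → s n ≡ s (suc n) ℤ.- a (suc n)
s[n]≡s[1+n]-a[1+n] n = sym (x+y-y≡x (s n) (a (suc n)))

s-3+4q : ∀ q → s (3 + 4 * q) ≡ s q ℤ.+ s q
s-3+4q zero    = refl
s-3+4q (suc q) = begin
  s (3 + 4 * suc q)
    ≡⟨ cong (λ i → s (3 + i)) (*-suc 4 q) ⟩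
  s (3 + 4 * q) ℤ.+ a (4 + 4 * q) ℤ.+ a (5 + 4 * q) ℤ.+ a (6 + 4 * q) ℤ.+ a (7 + 4 * q)
    ≡⟨ cong₂ ℤ._+_ (cong₂ ℤ._+_ (cong₂ ℤ._+_ (cong₂ ℤ._+_ (s-3+4q q)
         (trans (next 0) (a-4q (suc q)))) (trans (next 1) (a-1+4q (suc q))))
         (trans (next 2) (a-2+4q (suc q)))) (trans (next 3) (a-3+4q (suc q))) ⟩
  s q ℤ.+ s q ℤ.+ a (suc q) ℤ.+ a (suc q) ℤ.+ b (suc q) ℤ.+ ℤ.- b (suc q)
    ≡⟨ regroup (s q) (a (suc q)) (b (suc q)) ⟩
  s (suc q) ℤ.+ s (suc q)
    ∎
  where
  open ≡-Reasoning
  next : ∀ r → a (r + (4 + 4 * q)) ≡ a (r + 4 * suc q)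
  next r = cong (λ i → a (r + i)) (sym (*-suc 4 q))
  regroup : ∀ x y z → x ℤ.+ x ℤ.+ y ℤ.+ y ℤ.+ z ℤ.+ ℤ.- z ≡ (x ℤ.+ y) ℤ.+ (x ℤ.+ y)
  regroup = ℤ-Solver.solve-∀

s-2+4q : ∀ q → s (2 + 4 * q) ≡ s q ℤ.+ s q ℤ.+ b q
s-2+4q q = begin
  s (2 + 4 * q)                    ≡⟨ s[n]≡s[1+n]-a[1+n] (2 + 4 * q) ⟩
  s (3 + 4 * q) ℤ.- a (3 + 4 * q)  ≡⟨ cong₂ ℤ._-_ (s-3+4q q) (a-3+4q q) ⟩
  s q ℤ.+ s q ℤ.- ℤ.- b q          ≡⟨ cong (λ x → s q ℤ.+ s q ℤ.+ x) (ℤ.neg-involutive (b q)) ⟩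
  s q ℤ.+ s q ℤ.+ b q              ∎
  where open ≡-Reasoning

s-1+4q : ∀ q → s (1 + 4 * q) ≡ s q ℤ.+ s q
s-1+4q q = begin
  s (1 + 4 * q)                    ≡⟨ s[n]≡s[1+n]-a[1+n] (1 + 4 * q) ⟩
  s (2 + 4 * q) ℤ.- a (2 + 4 * q)  ≡⟨ cong₂ ℤ._-_ (s-2+4q q) (a-2+4q q) ⟩
  s q ℤ.+ s q ℤ.+ b q ℤ.- b q      ≡⟨ x+y-y≡x _ (b q) ⟩
  s q ℤ.+ s q                      ∎
  where open ≡-Reasoning

s-4q : ∀ q → s (4 * q) ≡ s q ℤ.+ s q ℤ.- a q
s-4q q = begin
  s (4 * q)                        ≡⟨ s[n]≡s[1+n]-a[1+n] (4 * q) ⟩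
  s (1 + 4 * q) ℤ.- a (1 + 4 * q)  ≡⟨ cong₂ ℤ._-_ (s-1+4q q) (a-1+4q q) ⟩
  s q ℤ.+ s q ℤ.- a q              ∎
  where open ≡-Reasoning

-- Binary digits read in base 4

-- m recurses through a where-bound worker go, which cannot be named outside Defs.
-- Abstracting the unfolded m (suc k) turns it into a pattern, so this meta gets solved,
-- and m-unfolded _+_ r p f h is r + 4 * go p f h (go p being the worker of m p).
mutual
  m-unfolded : (ℕ → ℕ → ℕ) → ℕ → ℕ → ℕ → ℕ → ℕ
  m-unfolded = _

  m-suc≡m-unfolded : ∀ k → m (suc k) ≡ m-unfolded _+_ (suc k % 2) (suc k) k (suc k / 2)
  m-suc≡m-unfolded k with suc k / 2 | suc k | suc k % 2 | _+_
  ... | _ | _ | _ | _ = refl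

4*m-worker : ℕ → ℕ → ℕ → ℕ
4*m-worker = m-unfolded _+_ 0

4*m-worker-fuel : ∀ {p p′ f g} x → x ≤ f → x ≤ g → 4*m-worker p f x ≡ 4*m-worker p′ g x
4*m-worker-fuel {f = zero}  {zero}  zero _ _ = refl
4*m-worker-fuel {f = zero}  {suc _} zero _ _ = refl
4*m-worker-fuel {f = suc _} {zero}  zero _ _ = refl
4*m-worker-fuel {f = suc _} {suc _} zero _ _ = refl
4*m-worker-fuel {p} {p′} {suc f} {suc g} (suc x) (s≤s x≤f) (s≤s x≤g) =
  cong (λ t → 4 * (suc x % 2 + t))
       (4*m-worker-fuel {p} {p′} (suc x / 2) (≤-trans ([1+n]/2≤n x) x≤f) (≤-trans ([1+n]/2≤n x) x≤g))

m-suc : ∀ k → m (suc k) ≡ suc k % 2 + 4 * m (suc k / 2)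
m-suc k = trans (m-suc≡m-unfolded k)
                (cong (λ t → suc k % 2 + t)
                      (4*m-worker-fuel {suc k} {suc k / 2} (suc k / 2) ([1+n]/2≤n k) ≤-refl))

m-double : ∀ j → m (2 * j) ≡ 4 * m j
m-double zero    = refl
m-double (suc j) = trans (m-suc (pred (2 * suc j)))
                         (cong₂ (λ r i → r + 4 * m i) (digit-% 2 (suc j) z<s) (digit-/ 2 (suc j) z<s))

m-double+1 : ∀ j → m (1 + 2 * j) ≡ 1 + 4 * m j
m-double+1 j = trans (m-suc (2 * j))
                     (cong₂ (λ r i → r + 4 * m i) (digit-% 2 j (s<s z<s)) (digit-/ 2 j (s<s z<s)))

m-double+2 : ∀ j → m (2 + 2 * j) ≡ 4 * m (suc j)
m-double+2 j = trans (cong m (sym (*-suc 2 j))) (m-double (suc j))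

m<m-suc : ∀ j → m j < m (suc j)
m<m-suc = digit-induction 2 (s<s z<s) (λ j → m j < m (suc j)) z<s (λ {q} → step {q})
  where
  open ≤-Reasoning
  step : ∀ {q} r → r < 2 → m q < m (suc q) → m (r + 2 * q) < m (suc (r + 2 * q))
  step {q} 0 _ _ = begin-strict
    m (2 * q)      ≡⟨ m-double q ⟩
    4 * m q        <⟨ n<1+n (4 * m q) ⟩
    1 + 4 * m q    ≡⟨ m-double+1 q ⟨
    m (1 + 2 * q)  ∎
  step {q} 1 _ mq<m[1+q] = begin-strict
    m (1 + 2 * q)  ≡⟨ m-double+1 q ⟩
    1 + 4 * m q    <⟨ +-monoˡ-< (4 * m q) {1} {4} (s≤s (s≤s z≤n)) ⟩
    4 + 4 * m q    ≡⟨ *-suc 4 (m q) ⟨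
    4 * suc (m q)  ≤⟨ *-monoʳ-≤ 4 mq<m[1+q] ⟩
    4 * m (suc q)  ≡⟨ m-double+2 q ⟨
    m (2 + 2 * q)  ∎
  step (suc (suc _)) (s≤s (s≤s ()))

-- The three bounds

data Plain (n j : ℕ) : Set where
  plain : 3 * n ≤ 5 * m j → Plain n j

data Strong (n j : ℕ) : Set where
  strong : 2 + 3 * n ≤ 5 * m j → Strong n j

data Weak (n j : ℕ) : Set where
  weak : 2 + 3 * n ≤ 2 * m (suc j) + 3 * m j → Weak n j

strong⇒plain : ∀ {n j} → Strong n j → Plain n j
strong⇒plain (strong h) = plain (≤-trans (m≤n+m _ 2) h)

plain⇒weak : ∀ {n j} → Plain n j → Weak n j
plain⇒weak {n} {j} (plain h) = weak $ begin
  2 + 3 * n                ≤⟨ +-monoʳ-≤ 2 h ⟩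
  2 + 5 * m j              ≡⟨ split (m j) ⟩
  2 * suc (m j) + 3 * m j  ≤⟨ +-monoˡ-≤ (3 * m j) (*-monoʳ-≤ 2 (m<m-suc j)) ⟩
  2 * m (suc j) + 3 * m j  ∎
  where
  open ≤-Reasoning
  split : ∀ x → 2 + 5 * x ≡ 2 * suc x + 3 * x
  split = ℕ-Solver.solve-∀

weak⇒3n≤5m[1+j] : ∀ {n j} → Weak n j → 3 * n ≤ 5 * m (suc j)
weak⇒3n≤5m[1+j] {n} {j} (weak h) = begin
  3 * n                          ≤⟨ m≤n+m _ 2 ⟩
  2 + 3 * n                      ≤⟨ h ⟩
  2 * m (suc j) + 3 * m j        ≤⟨ +-monoʳ-≤ (2 * m (suc j)) (*-monoʳ-≤ 3 (<⇒≤ (m<m-suc j))) ⟩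
  2 * m (suc j) + 3 * m (suc j)  ≡⟨ *-distribʳ-+ (m (suc j)) 2 3 ⟨
  5 * m (suc j)                  ∎
  where open ≤-Reasoning

digit-≤ : ∀ c d e r {x y} → d + 3 * r ≤ e + 4 * c → c + 3 * x ≤ y → d + 3 * (r + 4 * x) ≤ e + 4 * y
digit-≤ c d e r {x} {y} dr≤ec cx≤y = begin
  d + 3 * (r + 4 * x)        ≡⟨ split d r x ⟩
  (d + 3 * r) + 4 * (3 * x)  ≤⟨ +-monoˡ-≤ (4 * (3 * x)) dr≤ec ⟩
  (e + 4 * c) + 4 * (3 * x)  ≡⟨ merge e c x ⟩
  e + 4 * (c + 3 * x)        ≤⟨ +-monoʳ-≤ e (*-monoʳ-≤ 4 cx≤y) ⟩
  e + 4 * y                  ∎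
  where
  open ≤-Reasoning
  split : ∀ d r x → d + 3 * (r + 4 * x) ≡ (d + 3 * r) + 4 * (3 * x)
  split = ℕ-Solver.solve-∀
  merge : ∀ e c x → (e + 4 * c) + 4 * (3 * x) ≡ e + 4 * (c + 3 * x)
  merge = ℕ-Solver.solve-∀

4[5m[j]]≡5m[2j] : ∀ j → 4 * (5 * m j) ≡ 5 * m (2 * j)
4[5m[j]]≡5m[2j] j rewrite m-double j = identity (m j)
  where
  identity : ∀ x → 4 * (5 * x) ≡ 5 * (4 * x)
  identity = ℕ-Solver.solve-∀

5+4[5m[j]]≡5m[1+2j] : ∀ j → 5 + 4 * (5 * m j) ≡ 5 * m (1 + 2 * j)
5+4[5m[j]]≡5m[1+2j] j rewrite m-double+1 j = identity (m j)
  where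
  identity : ∀ x → 5 + 4 * (5 * x) ≡ 5 * (1 + 4 * x)
  identity = ℕ-Solver.solve-∀

3+4[2m[1+j]+3m[j]]≡2m[2+2j]+3m[1+2j] : ∀ j →
  3 + 4 * (2 * m (suc j) + 3 * m j) ≡ 2 * m (2 + 2 * j) + 3 * m (1 + 2 * j)
3+4[2m[1+j]+3m[j]]≡2m[2+2j]+3m[1+2j] j rewrite m-double+2 j | m-double+1 j = identity (m j) (m (suc j))
  where
  identity : ∀ x y → 3 + 4 * (2 * y + 3 * x) ≡ 2 * (4 * y) + 3 * (1 + 4 * x)
  identity = ℕ-Solver.solve-∀

4[2m[1+j]+3m[j]]≤5m[2+2j] : ∀ j → 4 * (2 * m (suc j) + 3 * m j) ≤ 5 * m (2 + 2 * j)
4[2m[1+j]+3m[j]]≤5m[2+2j] j = begin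
  4 * (2 * m (suc j) + 3 * m j)        ≤⟨ *-monoʳ-≤ 4 (+-monoʳ-≤ (2 * m (suc j)) (*-monoʳ-≤ 3 mj≤m[1+j])) ⟩
  4 * (2 * m (suc j) + 3 * m (suc j))  ≡⟨ identity (m (suc j)) ⟩
  5 * (4 * m (suc j))                  ≡⟨ cong (5 *_) (m-double+2 j) ⟨
  5 * m (2 + 2 * j)                    ∎
  where
  open ≤-Reasoning
  mj≤m[1+j] : m j ≤ m (suc j)
  mj≤m[1+j] = <⇒≤ (m<m-suc j)
  identity : ∀ y → 4 * (2 * y + 3 * y) ≡ 5 * (4 * y)
  identity = ℕ-Solver.solve-∀

module _ {q j : ℕ} where

  plain⇒plain-4q : Plain q j → Plain (4 * q) (2 * j)
  plain⇒plain-4q (plain h) = plain $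
    ≤-trans (digit-≤ 0 0 0 0 {q} z≤n h) (≤-reflexive (4[5m[j]]≡5m[2j] j))

  weak⇒strong-4q : Weak q j → Strong (4 * q) (2 + 2 * j)
  weak⇒strong-4q (weak h) = strong $
    ≤-trans (digit-≤ 2 2 0 0 {q} (≤ᵇ⇒≤ _ _ _) h) (4[2m[1+j]+3m[j]]≤5m[2+2j] j)

  plain⇒strong-1+4q : Plain q j → Strong (1 + 4 * q) (1 + 2 * j)
  plain⇒strong-1+4q (plain h) = strong $
    ≤-trans (digit-≤ 0 2 5 1 {q} ≤-refl h) (≤-reflexive (5+4[5m[j]]≡5m[1+2j] j))

  weak⇒weak-1+4q : Weak q j → Weak (1 + 4 * q) (1 + 2 * j)
  weak⇒weak-1+4q (weak h) = weak $
    ≤-trans (digit-≤ 2 2 3 1 {q} (≤ᵇ⇒≤ _ _ _) h) (≤-reflexive (3+4[2m[1+j]+3m[j]]≡2m[2+2j]+3m[1+2j] j))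

  weak⇒plain-2+4q : Weak q j → Plain (2 + 4 * q) (2 + 2 * j)
  weak⇒plain-2+4q (weak h) = plain $
    ≤-trans (digit-≤ 2 0 0 2 {q} (≤ᵇ⇒≤ _ _ _) h) (4[2m[1+j]+3m[j]]≤5m[2+2j] j)

  strong⇒strong-2+4q : Strong q j → Strong (2 + 4 * q) (2 * j)
  strong⇒strong-2+4q (strong h) = strong $
    ≤-trans (digit-≤ 2 2 0 2 {q} ≤-refl h) (≤-reflexive (4[5m[j]]≡5m[2j] j))

  weak⇒weak-3+4q : Weak q j → Weak (3 + 4 * q) (1 + 2 * j)
  weak⇒weak-3+4q (weak h) = weak $
    ≤-trans (digit-≤ 2 2 3 3 {q} ≤-refl h) (≤-reflexive (3+4[2m[1+j]+3m[j]]≡2m[2+2j]+3m[1+2j] j))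

  strong⇒strong-3+4q : Strong q j → Strong (3 + 4 * q) (1 + 2 * j)
  strong⇒strong-3+4q (strong h) = strong $
    ≤-trans (digit-≤ 2 2 5 3 {q} (≤ᵇ⇒≤ _ _ _) h) (≤-reflexive (5+4[5m[j]]≡5m[1+2j] j))

-- The invariant

Bounded : Sign → Sign → ℕ → ℕ → Set
Bounded _      Sign.- = Strong
Bounded Sign.+ Sign.+ = Plain
Bounded Sign.- Sign.+ = Weak

bounded⇒weak : ∀ {n j} α β → Bounded α β n j → Weak n j
bounded⇒weak _      Sign.- = plain⇒weak ∘ strong⇒plain
bounded⇒weak Sign.+ Sign.+ = plain⇒weak
bounded⇒weak Sign.- Sign.+ = id

bounded⁺⇒plain : ∀ {n j} β → Bounded Sign.+ β n j → Plain n j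
bounded⁺⇒plain Sign.+ = id
bounded⁺⇒plain Sign.- = strong⇒plain

record Invariant (n : ℕ) : Set where
  constructor mkInvariant
  field
    j     : ℕ
    α β   : Sign
    s≡    : s n ≡ ℤ.+ suc j
    a≡    : a n ≡ α ◃ 1
    b≡    : b n ≡ β ◃ 1
    bound : Bounded α β n j

module _ {x : ℤ} {j : ℕ} where

  double : x ≡ ℤ.+ suc j → x ℤ.+ x ≡ ℤ.+ suc (1 + 2 * j)
  double refl = cong ℤ.+_ (identity j)
    where
    identity : ∀ j → suc j + suc j ≡ suc (1 + 2 * j)
    identity = ℕ-Solver.solve-∀

  double+1 : ∀ {y} → x ≡ ℤ.+ suc j → y ≡ 1ℤ → x ℤ.+ x ℤ.+ y ≡ ℤ.+ suc (2 + 2 * j)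
  double+1 x≡ refl = trans (cong (ℤ._+ 1ℤ) (double x≡)) (cong ℤ.+_ (+-comm _ 1))

  double-1 : ∀ {y} → x ≡ ℤ.+ suc j → y ≡ -1ℤ → x ℤ.+ x ℤ.+ y ≡ ℤ.+ suc (2 * j)
  double-1 x≡ refl = cong (ℤ._+ -1ℤ) (double x≡)

module _ {q : ℕ} where

  invariant-4q : Invariant q → Invariant (4 * q)
  invariant-4q (mkInvariant j Sign.+ β s≡ a≡ _ bound) =
    mkInvariant (2 * j) Sign.+ Sign.+ (trans (s-4q q) (double-1 s≡ (cong ℤ.-_ a≡)))
      (trans (a-4q q) a≡) (trans (b-4q q) a≡) (plain⇒plain-4q (bounded⁺⇒plain β bound))
  invariant-4q (mkInvariant j Sign.- β s≡ a≡ _ bound) =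
    mkInvariant (2 + 2 * j) Sign.- Sign.- (trans (s-4q q) (double+1 s≡ (cong ℤ.-_ a≡)))
      (trans (a-4q q) a≡) (trans (b-4q q) a≡) (weak⇒strong-4q (bounded⇒weak Sign.- β bound))

  invariant-1+4q : Invariant q → Invariant (1 + 4 * q)
  invariant-1+4q (mkInvariant j Sign.+ β s≡ a≡ _ bound) =
    mkInvariant (1 + 2 * j) Sign.+ Sign.- (trans (s-1+4q q) (double s≡))
      (trans (a-1+4q q) a≡) (trans (b-1+4q q) (cong ℤ.-_ a≡)) (plain⇒strong-1+4q (bounded⁺⇒plain β bound))
  invariant-1+4q (mkInvariant j Sign.- β s≡ a≡ _ bound) =
    mkInvariant (1 + 2 * j) Sign.- Sign.+ (trans (s-1+4q q) (double s≡))
      (trans (a-1+4q q) a≡) (trans (b-1+4q q) (cong ℤ.-_ a≡)) (weak⇒weak-1+4q (bounded⇒weak Sign.- β bound))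

  invariant-2+4q : Invariant q → Invariant (2 + 4 * q)
  invariant-2+4q (mkInvariant j α Sign.+ s≡ _ b≡ bound) =
    mkInvariant (2 + 2 * j) Sign.+ Sign.+ (trans (s-2+4q q) (double+1 s≡ b≡))
      (trans (a-2+4q q) b≡) (trans (b-2+4q q) b≡) (weak⇒plain-2+4q (bounded⇒weak α Sign.+ bound))
  invariant-2+4q (mkInvariant j α Sign.- s≡ _ b≡ bound) =
    mkInvariant (2 * j) Sign.- Sign.- (trans (s-2+4q q) (double-1 s≡ b≡))
      (trans (a-2+4q q) b≡) (trans (b-2+4q q) b≡) (strong⇒strong-2+4q bound)

  invariant-3+4q : Invariant q → Invariant (3 + 4 * q)
  invariant-3+4q (mkInvariant j α Sign.+ s≡ _ b≡ bound) =
    mkInvariant (1 + 2 * j) Sign.- Sign.+ (trans (s-3+4q q) (double s≡))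
      (trans (a-3+4q q) (cong ℤ.-_ b≡)) (trans (b-3+4q q) b≡) (weak⇒weak-3+4q (bounded⇒weak α Sign.+ bound))
  invariant-3+4q (mkInvariant j α Sign.- s≡ _ b≡ bound) =
    mkInvariant (1 + 2 * j) Sign.+ Sign.- (trans (s-3+4q q) (double s≡))
      (trans (a-3+4q q) (cong ℤ.-_ b≡)) (trans (b-3+4q q) b≡) (strong⇒strong-3+4q bound)

invariant : ∀ n → Invariant n
invariant = digit-induction 4 (≤ᵇ⇒≤ _ _ _) Invariant (mkInvariant 0 Sign.+ Sign.+ refl refl refl (plain z≤n))
                            (λ {q} → step {q})
  where
  step : ∀ {q} r → r < 4 → Invariant q → Invariant (r + 4 * q)
  step 0 _ = invariant-4q
  step 1 _ = invariant-1+4q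
  step 2 _ = invariant-2+4q
  step 3 _ = invariant-3+4q
  step (suc (suc (suc (suc _)))) (s≤s (s≤s (s≤s (s≤s ()))))

3n≤5m[k] : ∀ {n k} → Invariant n → s n ≡ ℤ.+ k → 3 * n ≤ 5 * m k
3n≤5m[k] (mkInvariant j α β s≡ _ _ bound) s≡k with ℤ.+-injective (trans (sym s≡k) s≡)
... | refl = weak⇒3n≤5m[1+j] (bounded⇒weak α β bound)

-- Only s(n) = k is used: the bound holds for every n with s(n) = k, not just the largest.
lemma25 : ∀ (k : ℕ) → k ≥ 1 → ∀ (n : ℕ) → IsOmega k n → 3 * n ≤ 5 * m k
lemma25 k _ n (s≡k , _) = 3n≤5m[k] (invariant n) s≡k
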